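{- Let $G=(V,E)$ be a strongly connected finite directed multigraph equipped with a deadlock-free routing, and let $E=(e_1,\dots,e_m)$ be a total ordering of its edges consistent with the dependencies of this routing (i.e. whenever there is a dependency from $e_i$ to $e_j$, we have $i<j$). Let $s$ be the attraction number of this ordering and $G_s=(V,\{e_1,\dots,e_s\})$ its attraction subgraph. If $G_s$ has more than one global attractor, then there exists another total ordering of $E$ that is also consistent with the dependencies of the routing and whose attraction number is strictly smaller than $s$.
   Context: A routing for $G$ assigns, deterministically, to each ordered pair $(a,b)$ of distinct vertices a directed path from $a$ to $b$. There is a dependency from edge $e$ to edge $e'$ if some routing path uses $e'$ immediately after $e$; the dependency graph has vertex set $E$ and these dependencies as edges. The routing is deadlock-free if its dependency graph is acyclic. Parallel edges are considered distinct. A vertex of a directed graph is a global attractor if it is reachable from all other vertices. Given a total ordering $(e_1,\dots,e_m)$ of $E$, its attraction number is the smallest integer $s$ such that some vertex of $V$ is reachable from all other vertices using only edges in $\{e_1,\dots,e_s\}$ (reachability here is along arbitrary directed paths in that edge set, not required to respect the ordering). The attraction subgraph is $G_s=(V,\{e_1,\dots,e_s\})$. -}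

module Defs where

open import Data.Nat using (ℕ; _<_)
open import Data.Fin using (Fin; toℕ)
open import Data.Fin.Permutation using (Permutation′; _⟨$⟩ʳ_)
open import Data.List using (List; []; _∷_; _++_)
open import Data.Product using (Σ; ∃; ∃-syntax; _×_; _,_)
open import Relation.Nullary using (¬_)
open import Relation.Binary.PropositionalEquality using (_≡_; _≢_)
open import Relation.Binary.Construct.Closure.ReflexiveTransitive using (Star)
open import Relation.Binary.Construct.Closure.Transitive using (TransClosure)

record Multigraph : Set where
  field
    n   : ℕ
    m   : ℕ
    src : Fin m → Fin n
    tgt : Fin m → Fin n

module _ (G : Multigraph) where
  open Multigraph G

  Vertex : Set
  Vertex = Fin n

  Edge : Set
  Edge = Fin m

  Step : (Edge → Set) → Vertex → Vertex → Set
  Step S u v = Σ Edge λ e → S e × src e ≡ u × tgt e ≡ v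

  Reach : (Edge → Set) → Vertex → Vertex → Set
  Reach S = Star (Step S)

  AllEdges : Edge → Set
  AllEdges _ = Edge

  StronglyConnected : Set
  StronglyConnected = ∀ u v → Reach AllEdges u v

  data IsPath : Vertex → Vertex → List Edge → Set where
    one  : ∀ {a b} e → src e ≡ a → tgt e ≡ b → IsPath a b (e ∷ [])
    cons : ∀ {a b} e es → src e ≡ a → IsPath (tgt e) b es → IsPath a b (e ∷ es)

  record Routing : Set where
    field
      route   : (a b : Vertex) → a ≢ b → List Edge
      isPath  : (a b : Vertex) (h : a ≢ b) → IsPath a b (route a b h)

  UsedAfter : Edge → Edge → List Edge → Set
  UsedAfter e e' es = ∃[ xs ] ∃[ ys ] es ≡ xs ++ (e ∷ e' ∷ ys)

  Dep : Routing → Edge → Edge → Set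
  Dep R e e' = ∃[ a ] ∃[ b ] Σ (a ≢ b) λ h → UsedAfter e e' (Routing.route R a b h)

  DeadlockFree : Routing → Set
  DeadlockFree R = ∀ e → ¬ TransClosure (Dep R) e e

  -- a total ordering (e₁,…,e_m) of E: σ maps position i to edge e_{i+1}
  Ordering : Set
  Ordering = Permutation′ m

  Consistent : Routing → Ordering → Set
  Consistent R σ = ∀ i j → Dep R (σ ⟨$⟩ʳ i) (σ ⟨$⟩ʳ j) → toℕ i < toℕ j

  Prefix : Ordering → ℕ → Edge → Set
  Prefix σ s e = Σ (Fin m) λ i → toℕ i < s × σ ⟨$⟩ʳ i ≡ e

  GlobalAttractor : Ordering → ℕ → Vertex → Set
  GlobalAttractor σ s v = ∀ u → Reach (Prefix σ s) u v

  HasAttractor : Ordering → ℕ → Set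
  HasAttractor σ s = ∃[ v ] GlobalAttractor σ s v

  IsAttractionNumber : Ordering → ℕ → Set
  IsAttractionNumber σ s = HasAttractor σ s × (∀ s' → s' < s → ¬ HasAttractor σ s')

{-# OPTIONS --safe #-}
-- An edge of G_s leaving a global attractor of G_s ends in another one. Starting from the first
-- edge of a G_s-path between two distinct attractors and passing repeatedly to a later edge of
-- G_s continuing the current one, we reach an edge e_k out of an attractor c that no later edge
-- of G_s continues. Move e_k to the last place of G_s. Only the pairs (e_k, e_j) with e_j a later
-- edge of G_s change order, and a dependency from e_k to such an e_j would make e_j continue
-- e_k, so the new ordering is still consistent. Its first s − 1 edges are those of G_s except
-- e_k, which leaves c; a path to c can stop at its first visit to c, so c is still a global
-- attractor. Conversely its first t edges lie among the first t + 1 old ones, so no shorter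
-- prefix has an attractor, and the new attraction number is s − 1.
module Submission where

open import Defs
open import Data.Nat using (ℕ; _<_)
open import Data.Product using (Σ; ∃-syntax; _×_)
open import Relation.Binary.PropositionalEquality using (_≢_)

open import Data.Nat using (zero; suc; _≤_; z≤n; s≤s; _<?_)
open import Data.Nat.Properties
  using (≤-refl; ≤-trans; ≤-pred; <-irrefl; <-asym; <-cmp; <-≤-trans; ≤-<-trans; <⇒≱; ≮⇒≥; ≰⇒>;
         ≤∧≢⇒<; n≤1+n; n<1+n; m≤n⇒m≤1+n; module ≤-Reasoning)
open import Data.Fin using (Fin; toℕ; punchIn; punchOut; fromℕ<; _≟_)
  renaming (zero to fzero; suc to fsuc)
open import Data.Fin.Properties
  using (toℕ-injective; toℕ<n; toℕ-fromℕ<; any?; punchIn-punchOut; punchIn-mono-≤; punchIn-cancel-≤)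
open import Data.Fin.Induction using (>-wellFounded)
open import Data.Fin.Permutation
  using (Permutation′; _⟨$⟩ʳ_; _⟨$⟩ˡ_; insert; id; _∘ₚ_; inverseʳ; insert-punchIn)
open import Data.List using ([]; _∷_; _++_)
open import Data.Product using (∃; _,_; proj₁; proj₂; Σ-syntax)
open import Data.Sum using (_⊎_; inj₁; inj₂)
open import Function using (_∘_)
open import Induction.WellFounded using (Acc; acc)
open import Relation.Nullary using (¬_; yes; no; contradiction)
open import Relation.Nullary.Decidable using (_×-dec_)
open import Relation.Binary.Definitions using (tri<; tri≈; tri>)
open import Relation.Binary.PropositionalEquality
  using (_≡_; refl; sym; cong; subst; module ≡-Reasoning)
open import Relation.Binary.Construct.Closure.ReflexiveTransitive as Star using (ε; _◅_; _◅◅_)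

data PunchInView {n} (p : Fin (suc n)) : Fin (suc n) → Set where
  at      : PunchInView p p
  punched : ∀ x → PunchInView p (punchIn p x)

punchInView : ∀ {n} (p i : Fin (suc n)) → PunchInView p i
punchInView p i with p ≟ i
... | yes refl = at
... | no p≢i   = subst (PunchInView p) (punchIn-punchOut p≢i) (punched (punchOut p≢i))

toℕ≤toℕ-punchIn : ∀ {n} (i : Fin (suc n)) x → toℕ x ≤ toℕ (punchIn i x)
toℕ≤toℕ-punchIn fzero    x        = n≤1+n (toℕ x)
toℕ≤toℕ-punchIn (fsuc i) fzero    = z≤n
toℕ≤toℕ-punchIn (fsuc i) (fsuc x) = s≤s (toℕ≤toℕ-punchIn i x)

toℕ-punchIn≤suc : ∀ {n} (i : Fin (suc n)) x → toℕ (punchIn i x) ≤ suc (toℕ x)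
toℕ-punchIn≤suc fzero    x        = ≤-refl
toℕ-punchIn≤suc (fsuc i) fzero    = z≤n
toℕ-punchIn≤suc (fsuc i) (fsuc x) = s≤s (toℕ-punchIn≤suc i x)

toℕ-punchIn-≥ : ∀ {n} (i : Fin (suc n)) x → toℕ i ≤ toℕ x → toℕ (punchIn i x) ≡ suc (toℕ x)
toℕ-punchIn-≥ fzero    x        _         = refl
toℕ-punchIn-≥ (fsuc i) (fsuc x) (s≤s i≤x) = cong suc (toℕ-punchIn-≥ i x i≤x)

-- As a reordering, σ ↦ move k p ∘ₚ σ takes the entry at position k to position p and keeps
-- the other entries in their relative order.
move : ∀ {m} → Fin m → Fin m → Permutation′ m
move {suc n} k p = insert p k id

move-p : ∀ {m} (k p : Fin m) → move k p ⟨$⟩ʳ p ≡ k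
move-p {suc n} k p with p ≟ p
... | yes _   = refl
... | no  p≢p = contradiction refl p≢p

move-punchIn : ∀ {n} (k p : Fin (suc n)) x → move k p ⟨$⟩ʳ punchIn p x ≡ punchIn k x
move-punchIn k p = insert-punchIn p k id

move-≤-suc : ∀ {m} {k p : Fin m} → toℕ k ≤ toℕ p → ∀ i → toℕ (move k p ⟨$⟩ʳ i) ≤ suc (toℕ i)
move-≤-suc {suc n} {k} {p} k≤p i with punchInView p i
... | at rewrite move-p k p = m≤n⇒m≤1+n k≤p
... | punched x rewrite move-punchIn k p x =
  ≤-trans (toℕ-punchIn≤suc k x) (s≤s (toℕ≤toℕ-punchIn p x))

move-fixes-above : ∀ {m} {k p : Fin m} → toℕ k ≤ toℕ p → ∀ i → toℕ p < toℕ i → move k p ⟨$⟩ʳ i ≡ i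
move-fixes-above {suc n} {k} {p} k≤p i p<i with punchInView p i
... | at = contradiction p<i (<-irrefl refl)
... | punched x rewrite move-punchIn k p x = toℕ-injective (begin
  toℕ (punchIn k x) ≡⟨ toℕ-punchIn-≥ k x (≤-trans k≤p p≤x) ⟩
  suc (toℕ x)       ≡⟨ sym (toℕ-punchIn-≥ p x p≤x) ⟩
  toℕ (punchIn p x) ∎)
  where
  open ≡-Reasoning
  p≤x : toℕ p ≤ toℕ x
  p≤x = ≤-pred (<-≤-trans p<i (toℕ-punchIn≤suc p x))

move-below : ∀ {m} {k p : Fin m} j → toℕ j < toℕ p → toℕ (move k p ⟨$⟩ʳ j) ≤ toℕ p
move-below {suc n} {k} {p} j j<p with punchInView p j
... | at = contradiction j<p (<-irrefl refl)
... | punched y rewrite move-punchIn k p y =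
  ≤-trans (toℕ-punchIn≤suc k y) (≤-trans (s≤s (toℕ≤toℕ-punchIn p y)) j<p)

move-mono : ∀ {m} {k p : Fin m} {i j} → i ≢ p → j ≢ p → toℕ j ≤ toℕ i →
            toℕ (move k p ⟨$⟩ʳ j) ≤ toℕ (move k p ⟨$⟩ʳ i)
move-mono {suc n} {k} {p} {i} {j} i≢p j≢p j≤i with punchInView p i | punchInView p j
... | at        | _         = contradiction refl i≢p
... | _         | at        = contradiction refl j≢p
... | punched x | punched y rewrite move-punchIn k p x | move-punchIn k p y =
  punchIn-mono-≤ k y x (punchIn-cancel-≤ p y x j≤i)

move⁻¹-< : ∀ {m} {k p : Fin m} → toℕ k ≤ toℕ p → ∀ j → toℕ j ≤ toℕ p → j ≢ k →
           toℕ (move k p ⟨$⟩ˡ j) < toℕ p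
move⁻¹-< {k = k} {p} k≤p j j≤p j≢k with <-cmp (toℕ (move k p ⟨$⟩ˡ j)) (toℕ p)
... | tri< i<p _ _ = i<p
... | tri≈ _ i≡p _ = contradiction (begin
  j                               ≡⟨ sym (inverseʳ (move k p)) ⟩
  move k p ⟨$⟩ʳ (move k p ⟨$⟩ˡ j) ≡⟨ cong (move k p ⟨$⟩ʳ_) (toℕ-injective i≡p) ⟩
  move k p ⟨$⟩ʳ p                 ≡⟨ move-p k p ⟩
  k                               ∎) j≢k
  where open ≡-Reasoning
... | tri> _ _ p<i = contradiction j≤p (<⇒≱ (subst (λ x → toℕ p < toℕ x) preimage≡j p<i))
  where
  open ≡-Reasoning
  preimage≡j : move k p ⟨$⟩ˡ j ≡ j
  preimage≡j = begin
    move k p ⟨$⟩ˡ j                 ≡⟨ sym (move-fixes-above k≤p _ p<i) ⟩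
    move k p ⟨$⟩ʳ (move k p ⟨$⟩ˡ j) ≡⟨ inverseʳ (move k p) ⟩
    j                               ∎

ascend : ∀ {m} {P Q : Fin m → Set} → (∀ {k} → P k → Q k ⊎ ∃[ j ] (toℕ k < toℕ j × P j)) →
         ∀ {k} → P k → ∃ Q
ascend {P = P} {Q} step Pk = go Pk (>-wellFounded _)
  where
  go : ∀ {k} → P k → Acc _ k → ∃ Q
  go {k} Pk (acc later) with step Pk
  ... | inj₁ Qk             = k , Qk
  ... | inj₂ (j , k<j , Pj) = go Pj (later k<j)

module _ (G : Multigraph) where
  open Multigraph G

  IsPath-src : ∀ {a b e es} → IsPath G a b (e ∷ es) → src e ≡ a
  IsPath-src (one _ src≡a _)    = src≡a
  IsPath-src (cons _ _ src≡a _) = src≡a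

  IsPath-adjacent : ∀ {a b es} xs {e e′ ys} → IsPath G a b es → es ≡ xs ++ e ∷ e′ ∷ ys →
                    tgt e ≡ src e′
  IsPath-adjacent []          (one _ _ _)       ()
  IsPath-adjacent (_ ∷ [])    (one _ _ _)       ()
  IsPath-adjacent (_ ∷ _ ∷ _) (one _ _ _)       ()
  IsPath-adjacent []          (cons _ _ _ path) refl = sym (IsPath-src path)
  IsPath-adjacent (_ ∷ xs)    (cons _ _ _ path) refl = IsPath-adjacent xs path refl

  Dep⇒tgt≡src : ∀ (R : Routing G) {e e′} → Dep G R e e′ → tgt e ≡ src e′
  Dep⇒tgt≡src R (a , b , a≢b , xs , ys , route≡) =
    IsPath-adjacent xs (Routing.isPath R a b a≢b) route≡

  Reach-mono : ∀ {S T : Edge G → Set} → (∀ {e} → S e → T e) →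
               ∀ {u v} → Reach G S u v → Reach G T u v
  Reach-mono S⊆T = Star.map λ (e , Se , src≡ , tgt≡) → e , S⊆T Se , src≡ , tgt≡

  -- a walk to c may stop at its first visit to c
  Reach-without-exits : ∀ {S u c} → Reach G S u c → Reach G (λ e → S e × src e ≢ c) u c
  Reach-without-exits ε = ε
  Reach-without-exits {c = c} ((e , Se , refl , refl) ◅ walk) with src e ≟ c
  ... | yes refl = ε
  ... | no e≢c   = (e , (Se , e≢c) , refl , refl) ◅ Reach-without-exits walk

  HasAttractor-⊆ : ∀ {σ σ′ s s′} → (∀ {e} → Prefix G σ s e → Prefix G σ′ s′ e) →
                   HasAttractor G σ s → HasAttractor G σ′ s′
  HasAttractor-⊆ ⊆ (v , attracts) = v , λ u → Reach-mono ⊆ (attracts u)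

  module _ (σ : Ordering G) where

    GlobalAttractor-step : ∀ {s c d} → GlobalAttractor G σ s c → Step G (Prefix G σ s) c d →
                           GlobalAttractor G σ s d
    GlobalAttractor-step attracts step u = attracts u ◅◅ (step ◅ ε)

    attractionNumber-lastPosition : ∀ {s} → IsAttractionNumber G σ s → 0 < s →
                                    Σ[ p ∈ Fin m ] s ≡ suc (toℕ p)
    attractionNumber-lastPosition {zero}  _                     ()
    attractionNumber-lastPosition {suc t} (attractor , minimal) _ with t <? m
    ... | yes t<m = fromℕ< t<m , cong suc (sym (toℕ-fromℕ< t<m))
    ... | no t≮m  = contradiction (HasAttractor-⊆ {σ} {σ} everything-in-prefix attractor)
                                  (minimal t (n<1+n t))
      where
      everything-in-prefix : ∀ {e} → Prefix G σ (suc t) e → Prefix G σ t e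
      everything-in-prefix (i , _ , σi≡e) = i , <-≤-trans (toℕ<n i) (≮⇒≥ t≮m) , σi≡e

    ExitsAttractor : ℕ → Fin m → Set
    ExitsAttractor s k = toℕ k < s × GlobalAttractor G σ s (src (σ ⟨$⟩ʳ k))

    -- The pivot is the edge that gets moved to the end of G_s.
    record IsPivot (s : ℕ) (k : Fin m) : Set where
      field
        exits : ExitsAttractor s k
        last  : ∀ j → toℕ j < s → src (σ ⟨$⟩ʳ j) ≡ tgt (σ ⟨$⟩ʳ k) → toℕ j ≤ toℕ k

    IsPivot-or-later : ∀ {s k} → ExitsAttractor s k →
                       IsPivot s k ⊎ ∃[ j ] (toℕ k < toℕ j × ExitsAttractor s j)
    IsPivot-or-later {s} {k} exits@(k<s , attracts)
      with any? (λ j → toℕ j <? s ×-dec toℕ k <? toℕ j ×-dec src (σ ⟨$⟩ʳ j) ≟ tgt (σ ⟨$⟩ʳ k))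
    ... | yes (j , j<s , k<j , continues) =
      inj₂ (j , k<j , j<s , GlobalAttractor-step attracts step)
      where
      step : Step G (Prefix G σ s) (src (σ ⟨$⟩ʳ k)) (src (σ ⟨$⟩ʳ j))
      step = σ ⟨$⟩ʳ k , (k , k<s , refl) , refl , sym continues
    ... | no ¬later = inj₁ (record
      { exits = exits
      ; last  = λ j j<s continues → ≮⇒≥ λ k<j → ¬later (j , j<s , k<j , continues)
      })

    pivot-exists : ∀ {s v w} → v ≢ w → GlobalAttractor G σ s v → GlobalAttractor G σ s w →
                   ∃ (IsPivot s)
    pivot-exists {v = v} v≢w v-attracts w-attracts with w-attracts v
    ... | ε = contradiction refl v≢w
    ... | (_ , (i , i<s , refl) , refl , _) ◅ _ = ascend IsPivot-or-later (i<s , v-attracts)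

  module _ (R : Routing G) {σ : Ordering G} (consistent : Consistent G R σ) where

    IsPivot-no-dependency : ∀ {s k} → IsPivot σ s k → ∀ j → toℕ j < s →
                            ¬ Dep G R (σ ⟨$⟩ʳ k) (σ ⟨$⟩ʳ j)
    IsPivot-no-dependency pivot j j<s dep =
      <⇒≱ (consistent _ j dep) (IsPivot.last pivot j j<s (sym (Dep⇒tgt≡src R dep)))

    module _ {k p : Fin m} (pivot : IsPivot σ (suc (toℕ p)) k) where

      open IsPivot pivot using (exits)

      private
        ρ : Permutation′ m
        ρ = move k p

        k≤p : toℕ k ≤ toℕ p
        k≤p = ≤-pred (proj₁ exits)

      no-backward-dependency : ∀ {i j} → toℕ j ≤ toℕ i →
                               ¬ Dep G R (σ ⟨$⟩ʳ (ρ ⟨$⟩ʳ i)) (σ ⟨$⟩ʳ (ρ ⟨$⟩ʳ j))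
      no-backward-dependency {i} {j} j≤i dep with i ≟ p | j ≟ p
      ... | yes refl | yes refl = <-irrefl refl (consistent _ _ dep)
      ... | yes refl | no j≢p rewrite move-p k p =
        IsPivot-no-dependency pivot (ρ ⟨$⟩ʳ j) (s≤s (move-below j j<p)) dep
        where
        j<p : toℕ j < toℕ p
        j<p = ≤∧≢⇒< j≤i (j≢p ∘ toℕ-injective)
      ... | no i≢p | yes refl = <-asym (consistent _ _ dep) (begin-strict
        toℕ (ρ ⟨$⟩ʳ p) ≡⟨ cong toℕ (move-p k p) ⟩
        toℕ k          ≤⟨ k≤p ⟩
        toℕ p          <⟨ p<i ⟩
        toℕ i          ≡⟨ cong toℕ (move-fixes-above k≤p i p<i) ⟨
        toℕ (ρ ⟨$⟩ʳ i) ∎)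
        where
        open ≤-Reasoning
        p<i : toℕ p < toℕ i
        p<i = ≤∧≢⇒< j≤i (i≢p ∘ sym ∘ toℕ-injective)
      ... | no i≢p | no j≢p = <⇒≱ (consistent _ _ dep) (move-mono i≢p j≢p j≤i)

      move-consistent : Consistent G R (ρ ∘ₚ σ)
      move-consistent i j dep = ≰⇒> (λ j≤i → no-backward-dependency j≤i dep)

      move-prefix-⊆ : ∀ {t e} → Prefix G (ρ ∘ₚ σ) t e → Prefix G σ (suc t) e
      move-prefix-⊆ (i , i<t , refl) = ρ ⟨$⟩ʳ i , s≤s (≤-trans (move-≤-suc k≤p i) i<t) , refl

      prefix-without-exits⊆move-prefix : ∀ {e} →
        Prefix G σ (suc (toℕ p)) e × src e ≢ src (σ ⟨$⟩ʳ k) → Prefix G (ρ ∘ₚ σ) (toℕ p) e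
      prefix-without-exits⊆move-prefix ((j , j≤p , refl) , not-exit) =
        ρ ⟨$⟩ˡ j ,
        move⁻¹-< k≤p j (≤-pred j≤p) (not-exit ∘ cong (src ∘ (σ ⟨$⟩ʳ_))) ,
        cong (σ ⟨$⟩ʳ_) (inverseʳ ρ)

      move-attractor : GlobalAttractor G (ρ ∘ₚ σ) (toℕ p) (src (σ ⟨$⟩ʳ k))
      move-attractor u =
        Reach-mono prefix-without-exits⊆move-prefix (Reach-without-exits (proj₂ exits u))

      move-attractionNumber : IsAttractionNumber G σ (suc (toℕ p)) →
                              IsAttractionNumber G (ρ ∘ₚ σ) (toℕ p)
      move-attractionNumber (_ , minimal) =
        (_ , move-attractor) ,
        λ t t<p → minimal (suc t) (s≤s t<p) ∘ HasAttractor-⊆ {ρ ∘ₚ σ} {σ} move-prefix-⊆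

lemma2 : (G : Multigraph) → StronglyConnected G →
    (R : Routing G) → DeadlockFree G R →
    (σ : Ordering G) → Consistent G R σ →
    (s : ℕ) → IsAttractionNumber G σ s →
    (∃[ v ] ∃[ w ] (v ≢ w × GlobalAttractor G σ s v × GlobalAttractor G σ s w)) →
    ∃[ σ' ] (Consistent G R σ' × ∃[ s' ] (IsAttractionNumber G σ' s' × s' < s))
lemma2 G _ R _ σ consistent s isNumber (v , w , v≢w , v-attracts , w-attracts)
  with k , pivot ← pivot-exists G σ v≢w v-attracts w-attracts
  with attractionNumber-lastPosition G σ isNumber (≤-<-trans z≤n (proj₁ (IsPivot.exits pivot)))
... | p , refl =
  move k p ∘ₚ σ , move-consistent G R consistent pivot ,
  toℕ p , move-attractionNumber G R consistent pivot isNumber , n<1+n (toℕ p)
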